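{- For every positive integer $N$ there exists a numerical semigroup $S$ of embedding dimension four, with minimal generating set listed as $(n_1,n_2,n_3,n_4)$ in a suitable order, such that the number of \textsf{L}-shapes associated with the closed set $\mathrm{Ap}(S,n_4)$ is at least $N$. (That is, the number of different \textsf{L}-shapes for an embedding dimension four numerical semigroup is not upper bounded.)
   Context: A numerical semigroup generated by positive integers $n_1,\dots,n_k$ with $\gcd(n_1,\dots,n_k)=1$ is $S=\langle n_1,\dots,n_k\rangle=\{x_1n_1+\dots+x_kn_k : (x_1,\dots,x_k)\in\mathbb N^k\}$; if $\{n_1,\dots,n_k\}$ is a minimal generating set, $k$ is the embedding dimension. Write $Ax=x_1n_1+\dots+x_kn_k$ for $x\in\mathbb N^k$. For $a,b\in\mathbb Z$ write $a\le_S b$ if $b-a\in S$; a subset $C\subseteq S$ is closed if $a\in C$ and $b\le_S a$ imply $b\in C$. For $m\in S\setminus\{0\}$, the Apéry set is $\mathrm{Ap}(S,m)=\{s\in S : s-m\notin S\}$ (a closed set). For a nonempty closed $C\subseteq S$, a set $L\subseteq\mathbb N^k$ is an \textsf{L}-shape associated to $C$ if (C1) the map $x\mapsto Ax$ is a bijection from $L$ onto $C$, and (C2) whenever $x\in L$ and $y\in\mathbb N^k$ with $y\le x$ (componentwise), then $y\in L$. -}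

module Defs where

open import Data.Nat using (ℕ; zero; suc; _+_; _*_; _≤_; _<_)
open import Data.Nat.GCD using (gcd)
open import Data.Fin using (Fin)
open import Data.Vec using (Vec; []; _∷_; lookup)
open import Data.Product using (Σ; ∃; _×_)
open import Relation.Binary.PropositionalEquality using (_≡_)
open import Relation.Nullary using (¬_)

dot : ∀ {k} → Vec ℕ k → Vec ℕ k → ℕ
dot []       []       = 0
dot (n ∷ ns) (x ∷ xs) = x * n + dot ns xs

InS : ∀ {k} → Vec ℕ k → ℕ → Set
InS {k} n s = ∃ λ (x : Vec ℕ k) → dot n x ≡ s

_≤ᵥ_ : ∀ {k} → Vec ℕ k → Vec ℕ k → Set
_≤ᵥ_ {k} y x = ∀ (i : Fin k) → lookup y i ≤ lookup x i

-- (n₁,…,n₄) are positive, have gcd 1, and form a minimal generating set: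
-- no nᵢ is a combination of the other generators (this also forces them distinct),
-- so ⟨n₁,…,n₄⟩ is a numerical semigroup of embedding dimension 4.
IsMinGens4 : Vec ℕ 4 → Set
IsMinGens4 n =
  (∀ (i : Fin 4) → 0 < lookup n i)
  × gcd (lookup n Fin.zero) (gcd (lookup n (Fin.suc Fin.zero))
      (gcd (lookup n (Fin.suc (Fin.suc Fin.zero)))
           (lookup n (Fin.suc (Fin.suc (Fin.suc Fin.zero)))))) ≡ 1
  × (∀ (i : Fin 4) → ¬ (∃ λ (x : Vec ℕ 4) → lookup x i ≡ 0 × dot n x ≡ lookup n i))
  where import Data.Fin as Fin

Apery : ∀ {k} → Vec ℕ k → ℕ → ℕ → Set
Apery n m s = InS n s × ¬ (∃ λ t → InS n t × t + m ≡ s)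

IsLShape : ∀ {k} → Vec ℕ k → (ℕ → Set) → (Vec ℕ k → Set) → Set
IsLShape {k} n C L =
  ((x : Vec ℕ k) → L x → C (dot n x))
  × ((c : ℕ) → C c → ∃ λ (x : Vec ℕ k) → L x × dot n x ≡ c)
  × ((x y : Vec ℕ k) → L x → L y → dot n x ≡ dot n y → x ≡ y)
  × ((x y : Vec ℕ k) → L x → y ≤ᵥ x → L y)

SameSet : ∀ {k} → (Vec ℕ k → Set) → (Vec ℕ k → Set) → Set
SameSet {k} L L' = (x : Vec ℕ k) → (L x → L' x) × (L' x → L x)

-- Take S = ⟨M s₁, M s₂, M s₃, m⟩ with sᵢ = 2Q + i, B = 2Q + 5, m = s₂ B, M = m + 1 and Q = N.
-- A down-set L ⊆ ℕ⁴ is an L-shape of Ap(S, m) as soon as Ay + t m = Ax forces x = y on L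
-- and every Az has the form Ay + t m with y ∈ L.  For x₄ = 0 we have Ax = M τ(x) with
-- τ(x) = x₁ s₁ + x₂ s₂ + x₃ s₃, and M ≡ 1 (mod m), so both conditions live on τ.
-- For j ≤ Q, Shape Q j is a staircase in the (x₂, x₃)-plane together with a strip along the
-- x₁-axis whose length grows with j.  In base s₂ a staircase point has digits (x₂ + x₃, x₃) and
-- a strip point (x₁ - 1 + x₂, s₁ - (x₁ - 1)); since m = s₂ B, congruence modulo m compares
-- the low digits exactly and the high ones modulo B, and the two pieces are cut out so that
-- this forces equality.  Six explicit moves, each keeping τ modulo m, never increasing it and
-- lowering a weight, push every vector into Shape Q j.  Finally (Q + 2 + i, 0, 0, 0) lies in
-- Shape Q j exactly when i < j, so the N shapes are pairwise different.
module Submission where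

open import Defs
open import Data.Nat using (ℕ; _≤_)
open import Data.Fin using (Fin)
open import Data.Vec using (Vec; lookup)
open import Data.Product using (Σ; _×_)
open import Relation.Binary.PropositionalEquality using (_≢_)
open import Relation.Nullary using (¬_)

open import Data.Nat
open import Data.Nat.Properties
open import Data.Nat.Tactic.RingSolver
open import Data.Nat.Divisibility using (_∣_; divides; n∣m*n; ∣-trans; ∣m+n∣m⇒∣n; ∣1⇒≡1)
open import Data.Nat.GCD using (gcd; gcd[m,n]∣m; gcd[m,n]∣n)
open import Data.Nat.Induction using (<-wellFounded)
open import Induction.WellFounded using (Acc; acc)
open import Data.Fin using (toℕ)
open import Data.Fin.Properties using (toℕ<n; toℕ-injective)
open import Data.Fin.Patterns using (0F; 1F; 2F; 3F)
open import Data.Vec using ([]; _∷_; updateAt)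
open import Data.Product using (∃; _,_; proj₁; proj₂)
open import Data.Sum using (_⊎_; inj₁; inj₂)
open import Data.Empty using (⊥; ⊥-elim)
open import Function using (_∘_)
open import Relation.Nullary using (yes; no)
open import Relation.Binary.PropositionalEquality
open import Relation.Binary.Definitions using (tri<; tri≈; tri>)

-- Apéry sets of a generator

dot-updateAt : ∀ {k} (n x : Vec ℕ k) (i : Fin k) t →
               dot n (updateAt x i (_+ t)) ≡ dot n x + t * lookup n i
dot-updateAt (n₀ ∷ ns) (x₀ ∷ xs) Fin.zero    t = shift x₀ t n₀ (dot ns xs)
  where
  shift : ∀ x t n d → (x + t) * n + d ≡ x * n + d + t * n
  shift = solve-∀
dot-updateAt (n₀ ∷ ns) (x₀ ∷ xs) (Fin.suc i) t = begin
  x₀ * n₀ + dot ns (updateAt xs i (_+ t))  ≡⟨ cong (x₀ * n₀ +_) (dot-updateAt ns xs i t) ⟩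
  x₀ * n₀ + (dot ns xs + t * lookup ns i)  ≡⟨ +-assoc (x₀ * n₀) _ _ ⟨
  x₀ * n₀ + dot ns xs + t * lookup ns i    ∎
  where open ≡-Reasoning

InS-+*generator : ∀ {k} (n y : Vec ℕ k) (i : Fin k) t → InS n (dot n y + t * lookup n i)
InS-+*generator n y i t = updateAt y i (_+ t) , dot-updateAt n y i t

+-*suc-≢ : ∀ x t {m} → 0 < m → x + suc t * m ≢ x
+-*suc-≢ x t {suc m} _ = m+1+n≢m x

+-*suc : ∀ a t m → a + suc t * m ≡ a + t * m + m
+-*suc = solve-∀

Apery-isLShape : ∀ {k} (n : Vec ℕ k) (i : Fin k) (L : Vec ℕ k → Set) → 0 < lookup n i →
  (∀ x y → L x → y ≤ᵥ x → L y) →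
  (∀ x y t → L x → L y → dot n y + t * lookup n i ≡ dot n x → x ≡ y) →
  (∀ z → ∃ λ y → L y × ∃ λ t → dot n z ≡ dot n y + t * lookup n i) →
  IsLShape n (Apery n (lookup n i)) L
Apery-isLShape n i L m>0 closed injective reduce = sound , complete , unique , closed
  where
  m = lookup n i
  sound : ∀ x → L x → Apery n m (dot n x)
  sound x Lx = (x , refl) , λ { (s , (z , refl) , Az+m≡Ax) → not-below z Az+m≡Ax }
    where
    not-below : ∀ z → dot n z + m ≡ dot n x → ⊥
    not-below z Az+m≡Ax with reduce z
    ... | y , Ly , t , Az≡Ay+tm = cycle (injective x y (suc t) Lx Ly Ay+[1+t]m≡Ax) Ay+[1+t]m≡Ax
      where
      Ay+[1+t]m≡Ax = trans (+-*suc (dot n y) t m) (trans (cong (_+ m) (sym Az≡Ay+tm)) Az+m≡Ax)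
      cycle : x ≡ y → dot n y + suc t * m ≢ dot n x
      cycle refl = +-*suc-≢ (dot n x) t m>0
  complete : ∀ c → Apery n m c → ∃ λ x → L x × dot n x ≡ c
  complete c ((z , refl) , minimal) with reduce z
  ... | y , Ly , zero  , Az≡Ay = y , Ly , trans (sym (+-identityʳ _)) (sym Az≡Ay)
  ... | y , Ly , suc t , Az≡Ay+[1+t]m =
    ⊥-elim (minimal (dot n y + t * m , InS-+*generator n y i t ,
                     trans (sym (+-*suc (dot n y) t m)) (sym Az≡Ay+[1+t]m)))
  unique : ∀ x y → L x → L y → dot n x ≡ dot n y → x ≡ y
  unique x y Lx Ly Ax≡Ay = injective x y 0 Lx Ly (trans (+-identityʳ (dot n y)) (sym Ax≡Ay))

-- Arithmetic

*+-<-*+ : ∀ K {u v ρ σ} → ρ < K → u < v → K * u + ρ < K * v + σ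
*+-<-*+ K {u} {v} {ρ} {σ} ρ<K u<v = begin-strict
  K * u + ρ   <⟨ +-monoʳ-< (K * u) ρ<K ⟩
  K * u + K   ≡⟨ trans (+-comm (K * u) K) (sym (*-suc K u)) ⟩
  K * suc u   ≤⟨ *-monoʳ-≤ K u<v ⟩
  K * v       ≤⟨ m≤m+n (K * v) σ ⟩
  K * v + σ   ∎
  where open ≤-Reasoning

*+-injective : ∀ K {u v ρ σ} → ρ < K → σ < K → K * u + ρ ≡ K * v + σ → u ≡ v × ρ ≡ σ
*+-injective K {u} {v} ρ<K σ<K eq with <-cmp u v
... | tri< u<v _ _ = ⊥-elim (<-irrefl eq (*+-<-*+ K ρ<K u<v))
... | tri≈ _ refl _ = refl , +-cancelˡ-≡ (K * u) _ _ eq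
... | tri> _ _ v<u = ⊥-elim (<-irrefl (sym eq) (*+-<-*+ K σ<K v<u))

*+-congruent : ∀ K B {u ρ u′ ρ′} e → ρ < K → ρ′ < K →
               K * u + ρ ≡ K * u′ + ρ′ + e * (K * B) → u ≡ u′ + e * B × ρ ≡ ρ′
*+-congruent K B {u′ = u′} {ρ′} e ρ<K ρ′<K eq =
  *+-injective K ρ<K ρ′<K (trans eq (regroup K B u′ ρ′ e))
  where
  regroup : ∀ K B u′ ρ′ e → K * u′ + ρ′ + e * (K * B) ≡ K * (u′ + e * B) + ρ′
  regroup = solve-∀

<⇒≡+*⇒≡ : ∀ {b b′ B} e → b < B → b ≡ b′ + e * B → b ≡ b′
<⇒≡+*⇒≡ {b′ = b′} zero    _   eq = trans eq (+-identityʳ b′)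
<⇒≡+*⇒≡ {b′ = b′} {B} (suc e) b<B refl =
  ⊥-elim (<⇒≱ b<B (≤-trans (m≤m+n B (e * B)) (m≤n+m _ b′)))

suc*+*-congruent : ∀ m X Y k → suc m * Y + k * m ≡ suc m * X → ∃ λ e → X ≡ Y + e * m
suc*+*-congruent m X Y k eq with Y ≤? X
... | no Y≰X = ⊥-elim (<-irrefl (sym eq) (begin-strict
      suc m * X            <⟨ *-monoʳ-< (suc m) (≰⇒> Y≰X) ⟩
      suc m * Y            ≤⟨ m≤m+n _ _ ⟩
      suc m * Y + k * m    ∎))
  where open ≤-Reasoning
... | yes Y≤X with m≤n⇒∃[o]m+o≡n Y≤X
... | δ , refl = multiple (∣m+n∣m⇒∣n (divides k δm+δ≡km) (n∣m*n δ))
  where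
  δm+δ≡km : δ * m + δ ≡ k * m
  δm+δ≡km = begin
    δ * m + δ          ≡⟨ regroup δ m ⟩
    suc m * δ          ≡⟨ +-cancelˡ-≡ (suc m * Y) _ _
                            (trans (sym (*-distribˡ-+ (suc m) Y δ)) (sym eq)) ⟩
    k * m              ∎
    where
    open ≡-Reasoning
    regroup : ∀ δ m → δ * m + δ ≡ suc m * δ
    regroup = solve-∀
  multiple : m ∣ δ → ∃ λ e → Y + δ ≡ Y + e * m
  multiple (divides e δ≡em) = e , cong (Y +_) δ≡em

≡+*-trans : ∀ {x y z} e e′ m → x ≡ y + e * m → y ≡ z + e′ * m → x ≡ z + (e′ + e) * m
≡+*-trans {z = z} e e′ m refl refl = regroup z e′ e m
  where
  regroup : ∀ z e′ e m → z + e′ * m + e * m ≡ z + (e′ + e) * m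
  regroup = solve-∀

≡+suc⇒≢ : ∀ {U W} k → U ≡ W + suc k → U ≢ W
≡+suc⇒≢ {U} k eq refl = m≢1+m+n U (trans eq (+-suc U k))

-- The semigroups

s₁ s₂ s₃ B m : ℕ → ℕ
s₁ Q = 1 + 2 * Q
s₂ Q = 2 + 2 * Q
s₃ Q = 3 + 2 * Q
B Q = 5 + 2 * Q
m Q = s₂ Q * B Q

gens : ℕ → Vec ℕ 4
gens Q = suc (m Q) * s₁ Q ∷ suc (m Q) * s₂ Q ∷ suc (m Q) * s₃ Q ∷ m Q ∷ []

τ : ℕ → ℕ → ℕ → ℕ → ℕ
τ Q a b c = a * s₁ Q + b * s₂ Q + c * s₃ Q

dot-gens : ∀ Q a b c d → dot (gens Q) (a ∷ b ∷ c ∷ d ∷ []) ≡ suc (m Q) * τ Q a b c + d * m Q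
dot-gens Q a b c d = expand a b c d (s₁ Q) (s₂ Q) (s₃ Q) (m Q)
  where
  expand : ∀ a b c d x y z m →
    a * (suc m * x) + (b * (suc m * y) + (c * (suc m * z) + (d * m + 0)))
      ≡ suc m * (a * x + b * y + c * z) + d * m
  expand = solve-∀

dot-gens₀ : ∀ Q a b c → dot (gens Q) (a ∷ b ∷ c ∷ 0 ∷ []) ≡ suc (m Q) * τ Q a b c
dot-gens₀ Q a b c = trans (dot-gens Q a b c 0) (+-identityʳ _)

τ-≢s₁ : ∀ Q b c → τ Q 0 b c ≢ s₁ Q
τ-≢s₁ Q zero    zero    ()
τ-≢s₁ Q (suc b) c       = ≡+suc⇒≢ _ (expand Q b c)
  where
  expand : ∀ Q b c → suc b * (2 + 2 * Q) + c * (3 + 2 * Q)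
                     ≡ (1 + 2 * Q) + suc (b * (2 + 2 * Q) + c * (3 + 2 * Q))
  expand = solve-∀
τ-≢s₁ Q zero    (suc c) = ≡+suc⇒≢ _ (expand Q c)
  where
  expand : ∀ Q c → 0 * (2 + 2 * Q) + suc c * (3 + 2 * Q) ≡ (1 + 2 * Q) + suc (suc (c * (3 + 2 * Q)))
  expand = solve-∀

τ-≢s₂ : ∀ q a c → τ (suc q) a 0 c ≢ s₂ (suc q)
τ-≢s₂ q a (suc c) = ≡+suc⇒≢ _ (expand (suc q) a c)
  where
  expand : ∀ Q a c → a * (1 + 2 * Q) + 0 * (2 + 2 * Q) + suc c * (3 + 2 * Q)
                     ≡ (2 + 2 * Q) + suc (a * (1 + 2 * Q) + c * (3 + 2 * Q))
  expand = solve-∀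
τ-≢s₂ q zero          zero ()
τ-≢s₂ q (suc zero)    zero eq = ≡+suc⇒≢ 0 (expand (suc q)) (sym eq)
  where
  expand : ∀ Q → 2 + 2 * Q ≡ (1 * (1 + 2 * Q) + 0 * (2 + 2 * Q) + 0 * (3 + 2 * Q)) + 1
  expand = solve-∀
τ-≢s₂ q (suc (suc a)) zero = ≡+suc⇒≢ _ (expand q a)
  where
  expand : ∀ q a → suc (suc a) * (1 + 2 * suc q) + 0 * (2 + 2 * suc q) + 0 * (3 + 2 * suc q)
                   ≡ (2 + 2 * suc q) + suc (2 * q + 1 + a * (1 + 2 * suc q))
  expand = solve-∀

τ-≢s₃ : ∀ q a b → τ (suc q) a b 0 ≢ s₃ (suc q)
τ-≢s₃ q (suc (suc a)) b = ≡+suc⇒≢ _ (expand q a b)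
  where
  expand : ∀ q a b → suc (suc a) * (1 + 2 * suc q) + b * (2 + 2 * suc q) + 0 * (3 + 2 * suc q)
                     ≡ (3 + 2 * suc q) + suc (2 * q + a * (1 + 2 * suc q) + b * (2 + 2 * suc q))
  expand = solve-∀
τ-≢s₃ q (suc zero) (suc b) = ≡+suc⇒≢ _ (expand q b)
  where
  expand : ∀ q b → 1 * (1 + 2 * suc q) + suc b * (2 + 2 * suc q) + 0 * (3 + 2 * suc q)
                   ≡ (3 + 2 * suc q) + suc (2 * q + 1 + b * (2 + 2 * suc q))
  expand = solve-∀
τ-≢s₃ q zero (suc (suc b)) = ≡+suc⇒≢ _ (expand q b)
  where
  expand : ∀ q b → 0 * (1 + 2 * suc q) + suc (suc b) * (2 + 2 * suc q) + 0 * (3 + 2 * suc q)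
                   ≡ (3 + 2 * suc q) + suc (2 * q + 2 + b * (2 + 2 * suc q))
  expand = solve-∀
τ-≢s₃ q zero       zero       ()
τ-≢s₃ q (suc zero) zero       eq = ≡+suc⇒≢ 1 (expand (suc q)) (sym eq)
  where
  expand : ∀ Q → 3 + 2 * Q ≡ (1 * (1 + 2 * Q) + 0 * (2 + 2 * Q) + 0 * (3 + 2 * Q)) + 2
  expand = solve-∀
τ-≢s₃ q zero       (suc zero) eq = ≡+suc⇒≢ 0 (expand (suc q)) (sym eq)
  where
  expand : ∀ Q → 3 + 2 * Q ≡ (0 * (1 + 2 * Q) + 1 * (2 + 2 * Q) + 0 * (3 + 2 * Q)) + 1
  expand = solve-∀

suc*+*-≢ : ∀ {M U W} d → U ≢ W → W < M → suc M * U + d * M ≢ suc M * W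
suc*+*-≢ {M} {U} {W} d U≢W W<M eq with suc*+*-congruent M W U d eq
... | e , W≡U+eM = U≢W (sym (<⇒≡+*⇒≡ e W<M W≡U+eM))

suc*-≢ : ∀ {M} T → 0 < M → suc M * T ≢ M
suc*-≢ {M} zero    0<M eq = <⇒≢ 0<M (trans (sym (*-zeroʳ (suc M))) eq)
suc*-≢ {M} (suc T) _   eq = m≢1+m+n M (trans (sym eq) (expand M T))
  where
  expand : ∀ M T → suc M * suc T ≡ suc (M + (T + M * T))
  expand = solve-∀

B≤m : ∀ Q → B Q ≤ m Q
B≤m Q = m≤n*m (B Q) (s₂ Q)

gens-minimal : ∀ q → IsMinGens4 (gens (suc q))
gens-minimal q = positive , coprime , independent
  where
  Q = suc q
  M = suc (m Q)
  positive : ∀ i → 0 < lookup (gens Q) i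
  positive 0F = s≤s z≤n
  positive 1F = s≤s z≤n
  positive 2F = s≤s z≤n
  positive 3F = s≤s z≤n
  n₁ = M * s₁ Q
  n₂ = M * s₂ Q
  n₃ = M * s₃ Q
  g = gcd n₁ (gcd n₂ (gcd n₃ (m Q)))
  g∣n₁ : g ∣ n₁
  g∣n₁ = gcd[m,n]∣m n₁ (gcd n₂ (gcd n₃ (m Q)))
  g∣n₂ : g ∣ n₂
  g∣n₂ = ∣-trans (gcd[m,n]∣n n₁ (gcd n₂ (gcd n₃ (m Q)))) (gcd[m,n]∣m n₂ (gcd n₃ (m Q)))
  g∣m : g ∣ m Q
  g∣m = ∣-trans (gcd[m,n]∣n n₁ (gcd n₂ (gcd n₃ (m Q))))
          (∣-trans (gcd[m,n]∣n n₂ (gcd n₃ (m Q))) (gcd[m,n]∣n n₃ (m Q)))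
  g∣M : g ∣ M
  g∣M = ∣m+n∣m⇒∣n (subst (g ∣_) (expand M Q) g∣n₂) g∣n₁
    where
    expand : ∀ M Q → M * (2 + 2 * Q) ≡ M * (1 + 2 * Q) + M
    expand = solve-∀
  coprime : g ≡ 1
  coprime = ∣1⇒≡1 (∣m+n∣m⇒∣n (subst (g ∣_) (+-comm 1 (m Q)) g∣M) g∣m)
  independent : ∀ i → ¬ ∃ λ x → lookup x i ≡ 0 × dot (gens Q) x ≡ lookup (gens Q) i
  independent 0F ((_ ∷ b ∷ c ∷ d ∷ []) , refl , eq) =
    suc*+*-≢ d (τ-≢s₁ Q b c) (≤-trans (m≤n+m _ 3) (B≤m Q)) (trans (sym (dot-gens Q 0 b c d)) eq)
  independent 1F ((a ∷ _ ∷ c ∷ d ∷ []) , refl , eq) =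
    suc*+*-≢ d (τ-≢s₂ q a c) (≤-trans (m≤n+m _ 2) (B≤m Q)) (trans (sym (dot-gens Q a 0 c d)) eq)
  independent 2F ((a ∷ b ∷ _ ∷ d ∷ []) , refl , eq) =
    suc*+*-≢ d (τ-≢s₃ q a b) (≤-trans (m≤n+m _ 1) (B≤m Q)) (trans (sym (dot-gens Q a b 0 d)) eq)
  independent 3F ((a ∷ b ∷ c ∷ _ ∷ []) , refl , eq) =
    suc*-≢ (τ Q a b c) (s≤s z≤n) (trans (sym (dot-gens₀ Q a b c)) eq)

-- The shapes and injectivity of τ modulo m

BC : ℕ → ℕ → ℕ → ℕ → Set
BC Q j b c = b < B Q × c ≤ Q × (c + j ≤ Q ⊎ b + 2 * c + 2 ≤ 2 * suc Q)

data AB (Q j : ℕ) : ℕ → ℕ → Set where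
  near : ∀ {a b} → a ≤ Q → b < B Q → AB Q j a b
  tail : ∀ {a b} → Q < a → a ≤ Q + j → b + 2 * suc a ≤ B Q + 2 * suc Q → AB Q j a b

data Region (Q j : ℕ) : ℕ → ℕ → ℕ → Set where
  bc : ∀ {b c} → BC Q j b c → Region Q j 0 b c
  ab : ∀ {a b} → AB Q j a b → Region Q j (suc a) b 0

data Shape (Q j : ℕ) : Vec ℕ 4 → Set where
  shape : ∀ {a b c} → Region Q j a b c → Shape Q j (a ∷ b ∷ c ∷ 0 ∷ [])

τ-bc : ∀ Q b c → τ Q 0 b c ≡ s₂ Q * (b + c) + c
τ-bc = expand
  where
  expand : ∀ Q b c → 0 * (1 + 2 * Q) + b * (2 + 2 * Q) + c * (3 + 2 * Q) ≡ (2 + 2 * Q) * (b + c) + c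
  expand = solve-∀

τ-ab : ∀ Q {a} b → a ≤ s₁ Q → τ Q (suc a) b 0 ≡ s₂ Q * (a + b) + (s₁ Q ∸ a)
τ-ab Q {a} b a≤s₁ = +-cancelʳ-≡ a _ _ (begin
  τ Q (suc a) b 0 + a              ≡⟨ expand Q a b ⟩
  s₂ Q * (a + b) + s₁ Q            ≡⟨ cong (s₂ Q * (a + b) +_) (m∸n+n≡m a≤s₁) ⟨
  s₂ Q * (a + b) + (s₁ Q ∸ a + a)  ≡⟨ +-assoc (s₂ Q * (a + b)) _ a ⟨
  s₂ Q * (a + b) + (s₁ Q ∸ a) + a  ∎)
  where
  open ≡-Reasoning
  expand : ∀ Q a b → suc a * (1 + 2 * Q) + b * (2 + 2 * Q) + 0 * (3 + 2 * Q) + a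
                     ≡ (2 + 2 * Q) * (a + b) + (1 + 2 * Q)
  expand = solve-∀

≤⇒<s₁ : ∀ Q {x} → x ≤ Q + Q → x < s₁ Q
≤⇒<s₁ Q x≤ = s≤s (≤-trans x≤ (≤-reflexive (cong (Q +_) (sym (+-identityʳ Q)))))

≤⇒<s₂ : ∀ Q {x} → x ≤ Q → x < s₂ Q
≤⇒<s₂ Q x≤Q = s≤s (<⇒≤ (≤⇒<s₁ Q (≤-trans x≤Q (m≤m+n Q Q))))

AB⇒a≤s₁ : ∀ {Q j a b} → j ≤ Q → AB Q j a b → a ≤ s₁ Q
AB⇒a≤s₁ {Q} j≤Q (near a≤Q _) = <⇒≤ (≤⇒<s₁ Q (≤-trans a≤Q (m≤m+n Q Q)))
AB⇒a≤s₁ {Q} j≤Q (tail _ a≤Q+j _) = <⇒≤ (≤⇒<s₁ Q (≤-trans a≤Q+j (+-monoʳ-≤ Q j≤Q)))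

tail⇒b<B : ∀ {Q a b} → Q < a → b + 2 * suc a ≤ B Q + 2 * suc Q → b < B Q
tail⇒b<B {Q} {a} {b} Q<a b+2a≤ = +-cancelʳ-≤ (2 * suc Q) (suc b) (B Q) (begin
  suc b + 2 * suc Q   ≤⟨ +-monoʳ-≤ (suc b) (*-monoʳ-≤ 2 Q<a) ⟩
  suc b + 2 * a       ≤⟨ n≤1+n _ ⟩
  suc (suc b + 2 * a) ≡⟨ regroup b a ⟩
  b + 2 * suc a       ≤⟨ b+2a≤ ⟩
  B Q + 2 * suc Q     ∎)
  where
  open ≤-Reasoning
  regroup : ∀ b a → suc (suc b + 2 * a) ≡ b + 2 * suc a
  regroup = solve-∀

AB⇒b<B : ∀ {Q j a b} → AB Q j a b → b < B Q
AB⇒b<B (near _ b<B) = b<B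
AB⇒b<B (tail Q<a _ b+2a≤) = tail⇒b<B Q<a b+2a≤

+-≤-shift : ∀ {Q j a c} → c + j ≤ Q → a ≤ Q + j → c + a ≤ Q + Q
+-≤-shift {Q} {j} {a} {c} c+j≤Q a≤Q+j = +-cancelʳ-≤ j (c + a) (Q + Q) (begin
  c + a + j    ≡⟨ regroup c a j ⟩
  c + j + a    ≤⟨ +-mono-≤ c+j≤Q a≤Q+j ⟩
  Q + (Q + j)  ≡⟨ +-assoc Q Q j ⟨
  Q + Q + j    ∎)
  where
  open ≤-Reasoning
  regroup : ∀ c a j → c + a + j ≡ c + j + a
  regroup = solve-∀

BC-AB-crossing : ∀ {Q j a b b′ c} → BC Q j b c → AB Q j a b′ → c + a ≡ s₁ Q →
                 b + 2 * c + 2 ≤ 2 * suc Q × b′ + 2 * suc a ≤ B Q + 2 * suc Q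
BC-AB-crossing {Q} (_ , c≤Q , _) (near a≤Q _) sum =
  ⊥-elim (<-irrefl sum (≤⇒<s₁ Q (+-mono-≤ c≤Q a≤Q)))
BC-AB-crossing {Q} (_ , _ , inj₁ c+j≤Q) (tail _ a≤Q+j _) sum =
  ⊥-elim (<-irrefl sum (≤⇒<s₁ Q (+-≤-shift c+j≤Q a≤Q+j)))
BC-AB-crossing (_ , _ , inj₂ stair) (tail _ _ b′+2a≤) _ = stair , b′+2a≤

stair-collision : ∀ {Q a b c} → c + a ≡ s₁ Q → a ≤ b + c → b + 2 * c + 2 ≤ 2 * suc Q → ⊥
stair-collision {Q} {a} {b} {c} sum a≤b+c stair = 1+n≰n (begin
  suc (2 * suc Q)    ≡⟨ regroup₁ Q ⟩
  s₁ Q + 2           ≡⟨ cong (_+ 2) sum ⟨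
  c + a + 2          ≤⟨ +-monoˡ-≤ 2 (+-monoʳ-≤ c a≤b+c) ⟩
  c + (b + c) + 2    ≡⟨ regroup₂ b c ⟩
  b + 2 * c + 2      ≤⟨ stair ⟩
  2 * suc Q          ∎)
  where
  open ≤-Reasoning
  regroup₁ : ∀ Q → suc (2 * suc Q) ≡ 1 + 2 * Q + 2
  regroup₁ = solve-∀
  regroup₂ : ∀ b c → c + (b + c) + 2 ≡ b + 2 * c + 2
  regroup₂ = solve-∀

tail-collision : ∀ {Q a b′ c} → c + a ≡ s₁ Q → B Q + c ≤ a + b′ →
                 b′ + 2 * suc a ≤ B Q + 2 * suc Q → ⊥
tail-collision {Q} {a} {b′} {c} sum B+c≤a+b′ b′+2a≤ = 1+n≰n (begin
  suc (B Q + 2 * suc Q)   ≡⟨ regroup₁ (B Q) Q ⟩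
  B Q + s₁ Q + 2          ≡⟨ cong (λ x → B Q + x + 2) sum ⟨
  B Q + (c + a) + 2       ≡⟨ cong (_+ 2) (+-assoc (B Q) c a) ⟨
  B Q + c + a + 2         ≤⟨ +-monoˡ-≤ 2 (+-monoˡ-≤ a B+c≤a+b′) ⟩
  a + b′ + a + 2          ≡⟨ regroup₂ a b′ ⟩
  b′ + 2 * suc a          ≤⟨ b′+2a≤ ⟩
  B Q + 2 * suc Q         ∎)
  where
  open ≤-Reasoning
  regroup₁ : ∀ x Q → suc (x + 2 * suc Q) ≡ x + (1 + 2 * Q) + 2
  regroup₁ = solve-∀
  regroup₂ : ∀ a b′ → a + b′ + a + 2 ≡ b′ + 2 * suc a
  regroup₂ = solve-∀

BC-τ-injective : ∀ {Q j b c b′ c′} e → BC Q j b c → BC Q j b′ c′ →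
                 τ Q 0 b c ≡ τ Q 0 b′ c′ + e * m Q → b ≡ b′ × c ≡ c′
BC-τ-injective {Q} {b = b} {c} {b′} {c′} e (b<B , c≤Q , _) (_ , c′≤Q , _) eq = b≡b′ , c≡c′
  where
  digits : b + c ≡ b′ + c′ + e * B Q × c ≡ c′
  digits = *+-congruent (s₂ Q) (B Q) e (≤⇒<s₂ Q c≤Q) (≤⇒<s₂ Q c′≤Q)
             (trans (sym (τ-bc Q b c)) (trans eq (cong (_+ e * m Q) (τ-bc Q b′ c′))))
  c≡c′ = proj₂ digits
  regroup : ∀ b′ c x → b′ + c + x ≡ b′ + x + c
  regroup = solve-∀
  b≡b′ = <⇒≡+*⇒≡ e b<B (+-cancelʳ-≡ c _ _
           (trans (proj₁ digits) (trans (cong (λ x → b′ + x + e * B Q) (sym c≡c′)) (regroup b′ c _))))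

AB-τ-injective : ∀ {Q j a b a′ b′} e → j ≤ Q → AB Q j a b → AB Q j a′ b′ →
                 τ Q (suc a) b 0 ≡ τ Q (suc a′) b′ 0 + e * m Q → a ≡ a′ × b ≡ b′
AB-τ-injective {Q} {a = a} {b} {a′} {b′} e j≤Q p p′ eq = a≡a′ , b≡b′
  where
  digits : a + b ≡ a′ + b′ + e * B Q × s₁ Q ∸ a ≡ s₁ Q ∸ a′
  a≤s₁ = AB⇒a≤s₁ j≤Q p
  a′≤s₁ = AB⇒a≤s₁ j≤Q p′
  digits = *+-congruent (s₂ Q) (B Q) e (s≤s (m∸n≤m (s₁ Q) a)) (s≤s (m∸n≤m (s₁ Q) a′))
             (trans (sym (τ-ab Q b a≤s₁)) (trans eq (cong (_+ e * m Q) (τ-ab Q b′ a′≤s₁))))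
  a≡a′ = ∸-cancelˡ-≡ a≤s₁ a′≤s₁ (proj₂ digits)
  b≡b′ = <⇒≡+*⇒≡ e (AB⇒b<B p) (+-cancelˡ-≡ a _ _
           (trans (proj₁ digits) (trans (cong (λ x → x + b′ + e * B Q) (sym a≡a′)) (+-assoc a b′ _))))

τ-BC≢AB : ∀ {Q j a b b′ c} e → j ≤ Q → BC Q j b c → AB Q j a b′ →
          τ Q 0 b c ≢ τ Q (suc a) b′ 0 + e * m Q
τ-BC≢AB {Q} {a = a} {b} {b′} {c} e j≤Q p p′ eq =
  stair-collision sum a≤b+c (proj₁ (BC-AB-crossing p p′ sum))
  where
  digits : b + c ≡ a + b′ + e * B Q × c ≡ s₁ Q ∸ a
  digits = *+-congruent (s₂ Q) (B Q) e (≤⇒<s₂ Q (proj₁ (proj₂ p))) (s≤s (m∸n≤m (s₁ Q) a))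
             (trans (sym (τ-bc Q b c)) (trans eq (cong (_+ e * m Q) (τ-ab Q b′ (AB⇒a≤s₁ j≤Q p′)))))
  sum : c + a ≡ s₁ Q
  sum = trans (cong (_+ a) (proj₂ digits)) (m∸n+n≡m (AB⇒a≤s₁ j≤Q p′))
  a≤b+c : a ≤ b + c
  a≤b+c = ≤-trans (≤-trans (m≤m+n a b′) (m≤m+n _ _)) (≤-reflexive (sym (proj₁ digits)))

τ-AB≢BC : ∀ {Q j a b b′ c} e → j ≤ Q → AB Q j a b′ → BC Q j b c →
          τ Q (suc a) b′ 0 ≢ τ Q 0 b c + e * m Q
τ-AB≢BC {Q} {a = a} {b} {b′} {c} e j≤Q p p′ eq = collide e (proj₁ digits)
  where
  digits : a + b′ ≡ b + c + e * B Q × s₁ Q ∸ a ≡ c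
  digits = *+-congruent (s₂ Q) (B Q) e (s≤s (m∸n≤m (s₁ Q) a)) (≤⇒<s₂ Q (proj₁ (proj₂ p′)))
             (trans (sym (τ-ab Q b′ (AB⇒a≤s₁ j≤Q p))) (trans eq (cong (_+ e * m Q) (τ-bc Q b c))))
  sum : c + a ≡ s₁ Q
  sum = trans (cong (_+ a) (sym (proj₂ digits))) (m∸n+n≡m (AB⇒a≤s₁ j≤Q p))
  crossing = BC-AB-crossing p′ p sum
  regroup : ∀ B b c x → B + c + (b + x) ≡ b + c + (B + x)
  regroup = solve-∀
  collide : ∀ e → a + b′ ≡ b + c + e * B Q → ⊥
  collide zero    eq′ = stair-collision sum
    (≤-trans (m≤m+n a b′) (≤-reflexive (trans eq′ (+-identityʳ _)))) (proj₁ crossing)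
  collide (suc e) eq′ = tail-collision sum
    (≤-trans (m≤m+n _ _) (≤-reflexive (trans (regroup (B Q) b c (e * B Q)) (sym eq′))))
    (proj₂ crossing)

Region-τ-injective : ∀ {Q j a b c a′ b′ c′} e → j ≤ Q → Region Q j a b c → Region Q j a′ b′ c′ →
                     τ Q a b c ≡ τ Q a′ b′ c′ + e * m Q → a ≡ a′ × b ≡ b′ × c ≡ c′
Region-τ-injective e _   (bc p) (bc p′) eq = refl , BC-τ-injective e p p′ eq
Region-τ-injective e j≤Q (bc p) (ab p′) eq = ⊥-elim (τ-BC≢AB e j≤Q p p′ eq)
Region-τ-injective e j≤Q (ab p) (bc p′) eq = ⊥-elim (τ-AB≢BC e j≤Q p p′ eq)
Region-τ-injective e j≤Q (ab p) (ab p′) eq =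
  let a≡a′ , b≡b′ = AB-τ-injective e j≤Q p p′ eq in cong suc a≡a′ , b≡b′ , refl

BC-closed : ∀ {Q j b c b′ c′} → b′ ≤ b → c′ ≤ c → BC Q j b c → BC Q j b′ c′
BC-closed {j = j} b′≤b c′≤c (b<B , c≤Q , inj₁ c+j≤Q) =
  ≤-<-trans b′≤b b<B , ≤-trans c′≤c c≤Q , inj₁ (≤-trans (+-monoˡ-≤ j c′≤c) c+j≤Q)
BC-closed b′≤b c′≤c (b<B , c≤Q , inj₂ stair) =
  ≤-<-trans b′≤b b<B , ≤-trans c′≤c c≤Q ,
  inj₂ (≤-trans (+-monoˡ-≤ 2 (+-mono-≤ b′≤b (*-monoʳ-≤ 2 c′≤c))) stair)

AB-closed : ∀ {Q j a b a′ b′} → a′ ≤ a → b′ ≤ b → AB Q j a b → AB Q j a′ b′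
AB-closed a′≤a b′≤b (near a≤Q b<B) = near (≤-trans a′≤a a≤Q) (≤-<-trans b′≤b b<B)
AB-closed {Q} {a′ = a′} a′≤a b′≤b (tail Q<a a≤Q+j b+2a≤) with a′ ≤? Q
... | yes a′≤Q = near a′≤Q (≤-<-trans b′≤b (tail⇒b<B Q<a b+2a≤))
... | no  a′≰Q = tail (≰⇒> a′≰Q) (≤-trans a′≤a a≤Q+j)
                      (≤-trans (+-mono-≤ b′≤b (*-monoʳ-≤ 2 (s≤s a′≤a))) b+2a≤)

Region-closed : ∀ {Q j a b c a′ b′ c′} → j ≤ Q → a′ ≤ a → b′ ≤ b → c′ ≤ c →
                Region Q j a b c → Region Q j a′ b′ c′
Region-closed _   z≤n       b′≤b c′≤c (bc p) = bc (BC-closed b′≤b c′≤c p)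
Region-closed j≤Q z≤n       b′≤b z≤n  (ab p) = bc (≤-<-trans b′≤b (AB⇒b<B p) , z≤n , inj₁ j≤Q)
Region-closed _   (s≤s a′≤a) b′≤b z≤n (ab p) = ab (AB-closed a′≤a b′≤b p)

-- Moving vectors into a shape

weight : ℕ → ℕ → ℕ → ℕ → ℕ → ℕ
weight j r a b c =
  a * (s₁ (j + r) + (1 + 2 * r)) + b * s₂ (j + r) + c * (s₃ (j + r) + (3 + 4 * j + 2 * r))

record Move (j r a b c : ℕ) : Set where
  constructor move
  field
    a′ b′ c′ e : ℕ
    congruent  : τ (j + r) a b c ≡ τ (j + r) a′ b′ c′ + e * m (j + r)
    lighter    : weight j r a′ b′ c′ < weight j r a b c

≡suc+⇒< : ∀ {x y d} → y ≡ suc (x + d) → x < y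
≡suc+⇒< {x} {d = d} refl = s≤s (m≤m+n x d)

move-ac : ∀ j r a b c → Move j r (suc a) b (suc c)
move-ac j r a b c = move a (2 + b) c 0 (congruent (j + r) a b c) (≡suc+⇒< (drop j r a b c))
  where
  congruent : ∀ Q a b c →
    let τ′ : ℕ → ℕ → ℕ → ℕ
        τ′ x y z = x * (1 + 2 * Q) + y * (2 + 2 * Q) + z * (3 + 2 * Q)
    in τ′ (suc a) b (suc c) ≡ τ′ a (2 + b) c + 0 * ((2 + 2 * Q) * (5 + 2 * Q))
  congruent = solve-∀
  drop : ∀ j r a b c →
    let Q = j + r
        w : ℕ → ℕ → ℕ → ℕ
        w x y z = x * (1 + 2 * Q + (1 + 2 * r)) + y * (2 + 2 * Q) + z * (3 + 2 * Q + (3 + 4 * j + 2 * r))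
    in w (suc a) b (suc c) ≡ suc (w a (2 + b) c + (4 * j + 4 * r + 3))
  drop = solve-∀

move-b : ∀ j r a b c → Move j r a (B (j + r) + b) c
move-b j r a b c = move a b c 1 (congruent (j + r) a b c) (≡suc+⇒< (drop j r a b c))
  where
  congruent : ∀ Q a b c →
    let τ′ : ℕ → ℕ → ℕ → ℕ
        τ′ x y z = x * (1 + 2 * Q) + y * (2 + 2 * Q) + z * (3 + 2 * Q)
    in τ′ a (5 + 2 * Q + b) c ≡ τ′ a b c + 1 * ((2 + 2 * Q) * (5 + 2 * Q))
  congruent = solve-∀
  drop : ∀ j r a b c →
    let Q = j + r
        w : ℕ → ℕ → ℕ → ℕ
        w x y z = x * (1 + 2 * Q + (1 + 2 * r)) + y * (2 + 2 * Q) + z * (3 + 2 * Q + (3 + 4 * j + 2 * r))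
    in w a (5 + 2 * Q + b) c ≡ suc (w a b c + (4 * Q * Q + 14 * Q + 9))
  drop = solve-∀

move-c : ∀ j r b c → Move j r 0 b (suc (j + r) + c)
move-c j r b c = move (suc (j + r)) (suc b) c 0 (congruent (j + r) b c) (≡suc+⇒< (drop j r b c))
  where
  congruent : ∀ Q b c →
    let τ′ : ℕ → ℕ → ℕ → ℕ
        τ′ x y z = x * (1 + 2 * Q) + y * (2 + 2 * Q) + z * (3 + 2 * Q)
    in τ′ 0 b (suc Q + c) ≡ τ′ (suc Q) (suc b) c + 0 * ((2 + 2 * Q) * (5 + 2 * Q))
  congruent = solve-∀
  drop : ∀ j r b c →
    let Q = j + r
        w : ℕ → ℕ → ℕ → ℕ
        w x y z = x * (1 + 2 * Q + (1 + 2 * r)) + y * (2 + 2 * Q) + z * (3 + 2 * Q + (3 + 4 * j + 2 * r))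
    in w 0 b (suc Q + c) ≡ suc (w (suc Q) (suc b) c + (4 * j * j + 4 * j * r + 6 * j + 2 * r + 1))
  drop = solve-∀

move-stair : ∀ p i r b → Move (suc (p + i)) r 0 (2 * i + 1 + b) (suc (r + p))
move-stair p i r b = move (suc (suc (p + i) + r) + suc i) b 0 0 (congruent p i r b) (≡suc+⇒< (drop p i r b))
  where
  congruent : ∀ p i r b →
    let Q = suc (p + i) + r
        τ′ : ℕ → ℕ → ℕ → ℕ
        τ′ x y z = x * (1 + 2 * Q) + y * (2 + 2 * Q) + z * (3 + 2 * Q)
    in τ′ 0 (2 * i + 1 + b) (suc (r + p)) ≡ τ′ (suc Q + suc i) b 0 + 0 * ((2 + 2 * Q) * (5 + 2 * Q))
  congruent = solve-∀
  drop : ∀ p i r b →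
    let Q = suc (p + i) + r
        w : ℕ → ℕ → ℕ → ℕ
        w x y z = x * (1 + 2 * Q + (1 + 2 * r)) + y * (2 + 2 * Q) + z * (3 + 2 * Q + (3 + 4 * suc (p + i) + 2 * r))
    in w 0 (2 * i + 1 + b) (suc (r + p)) ≡ suc (w (suc Q + suc i) b 0 + (4 * (p + i + r + 2) * p + 2 * (p + i + r + 1) + 1))
  drop = solve-∀

move-a : ∀ j r a b → Move j r (suc (suc (j + r) + j + a)) b 0
move-a j r a b = move a (b + suc (2 * j)) r 0 (congruent j r a b) (≡suc+⇒< (drop j r a b))
  where
  congruent : ∀ j r a b →
    let Q = j + r
        τ′ : ℕ → ℕ → ℕ → ℕ
        τ′ x y z = x * (1 + 2 * Q) + y * (2 + 2 * Q) + z * (3 + 2 * Q)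
    in τ′ (suc (suc Q + j + a)) b 0 ≡ τ′ a (b + suc (2 * j)) r + 0 * ((2 + 2 * Q) * (5 + 2 * Q))
  congruent = solve-∀
  drop : ∀ j r a b →
    let Q = j + r
        w : ℕ → ℕ → ℕ → ℕ
        w x y z = x * (1 + 2 * Q + (1 + 2 * r)) + y * (2 + 2 * Q) + z * (3 + 2 * Q + (3 + 4 * j + 2 * r))
    in w (suc (suc Q + j + a)) b 0 ≡ suc (w a (b + suc (2 * j)) r + (2 * r + 2 * j + 1))
  drop = solve-∀

move-tail : ∀ i p r b → Move (suc (i + p)) r (suc (suc (suc (i + p) + r) + i)) (2 * p + 2 * r + 6 + b) 0
move-tail i p r b = move 0 b (suc (p + r)) 1 (congruent i p r b) (≡suc+⇒< (drop i p r b))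
  where
  congruent : ∀ i p r b →
    let Q = suc (i + p) + r
        τ′ : ℕ → ℕ → ℕ → ℕ
        τ′ x y z = x * (1 + 2 * Q) + y * (2 + 2 * Q) + z * (3 + 2 * Q)
    in τ′ (suc (suc Q + i)) (2 * p + 2 * r + 6 + b) 0 ≡ τ′ 0 b (suc (p + r)) + 1 * ((2 + 2 * Q) * (5 + 2 * Q))
  congruent = solve-∀
  drop : ∀ i p r b →
    let Q = suc (i + p) + r
        w : ℕ → ℕ → ℕ → ℕ
        w x y z = x * (1 + 2 * Q + (1 + 2 * r)) + y * (2 + 2 * Q) + z * (3 + 2 * Q + (3 + 4 * suc (i + p) + 2 * r))
    in w (suc (suc Q + i)) (2 * p + 2 * r + 6 + b) 0 ≡ suc (w 0 b (suc (p + r)) + (4 * (i + p + r + 1) * (i + r + 3) + 4 * i + 4 * r + 11))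
  drop = solve-∀

stair-overflow-b : ∀ p i r b → ¬ (b + 2 * suc (r + p) + 2 ≤ 2 * suc (suc (p + i) + r)) → 2 * i + 1 ≤ b
stair-overflow-b p i r b stair≰ = +-cancelʳ-≤ (2 * p + 2 * r + 4) (2 * i + 1) b
  (subst₂ _≤_ (regroup₁ p i r) (regroup₂ b r p) (≰⇒> stair≰))
  where
  regroup₁ : ∀ p i r → suc (2 * suc (suc (p + i) + r)) ≡ 2 * i + 1 + (2 * p + 2 * r + 4)
  regroup₁ = solve-∀
  regroup₂ : ∀ b r p → b + 2 * suc (r + p) + 2 ≡ b + (2 * p + 2 * r + 4)
  regroup₂ = solve-∀

tail-overflow-b : ∀ i p r b →
  ¬ (b + 2 * suc (suc (suc (i + p) + r) + i) ≤ B (suc (i + p) + r) + 2 * suc (suc (i + p) + r)) →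
  2 * p + 2 * r + 6 ≤ b
tail-overflow-b i p r b tail≰ = +-cancelʳ-≤ (2 * (suc (i + p) + r) + 4 + 2 * i) (2 * p + 2 * r + 6) b
  (subst₂ _≤_ (regroup₁ i p r) (regroup₂ b i p r) (≰⇒> tail≰))
  where
  regroup₁ : ∀ i p r → suc (5 + 2 * (suc (i + p) + r) + 2 * suc (suc (i + p) + r))
                       ≡ 2 * p + 2 * r + 6 + (2 * (suc (i + p) + r) + 4 + 2 * i)
  regroup₁ = solve-∀
  regroup₂ : ∀ b i p r → b + 2 * suc (suc (suc (i + p) + r) + i) ≡ b + (2 * (suc (i + p) + r) + 4 + 2 * i)
  regroup₂ = solve-∀

-- Views: a point that just fails to be in the staircase (strip) has coordinates of the
-- form displayed in the index of overflow, which is the source of move-stair (move-tail).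
data StairOverflow (r : ℕ) : ℕ → ℕ → ℕ → Set where
  overflow : ∀ p i b → StairOverflow r (suc (p + i)) (2 * i + 1 + b) (suc (r + p))

stair-overflow : ∀ j r b c → c ≤ j + r → ¬ (c + j ≤ j + r) → ¬ (b + 2 * c + 2 ≤ 2 * suc (j + r)) →
                 StairOverflow r j b c
stair-overflow j r b c c≤Q c+j≰Q stair≰
  with m≤n⇒∃[o]m+o≡n (+-cancelʳ-≤ j (suc r) c (subst (_≤ c + j) (cong suc (+-comm j r)) (≰⇒> c+j≰Q)))
... | p , refl
  with m≤n⇒∃[o]m+o≡n (+-cancelʳ-≤ r (suc p) j (subst (_≤ j + r) (cong suc (+-comm r p)) c≤Q))
... | i , refl
  with m≤n⇒∃[o]m+o≡n (stair-overflow-b p i r b stair≰)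
... | b₀ , refl = overflow p i b₀

data TailOverflow (r : ℕ) : ℕ → ℕ → ℕ → Set where
  overflow : ∀ i p b → TailOverflow r (suc (i + p)) (suc (suc (i + p) + r) + i) (2 * p + 2 * r + 6 + b)

tail-overflow : ∀ j r a b → j + r < a → a ≤ j + r + j →
                ¬ (b + 2 * suc a ≤ B (j + r) + 2 * suc (j + r)) → TailOverflow r j a b
tail-overflow j r a b Q<a a≤Q+j tail≰
  with m≤n⇒∃[o]m+o≡n Q<a
... | i , refl
  with m≤n⇒∃[o]m+o≡n (+-cancelˡ-≤ (j + r) (suc i) j (subst (_≤ j + r + j) (sym (+-suc (j + r) i)) a≤Q+j))
... | p , refl
  with m≤n⇒∃[o]m+o≡n (tail-overflow-b i p r b tail≰)
... | b₀ , refl = overflow i p b₀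

classify-bc : ∀ j r b c → b < B (j + r) → Region (j + r) j 0 b c ⊎ Move j r 0 b c
classify-bc j r b c b<B with c ≤? j + r
... | no c≰Q with m≤n⇒∃[o]m+o≡n (≰⇒> c≰Q)
...   | c₀ , refl = inj₂ (move-c j r b c₀)
classify-bc j r b c b<B | yes c≤Q with c + j ≤? j + r
... | yes c+j≤Q = inj₁ (bc (b<B , c≤Q , inj₁ c+j≤Q))
... | no c+j≰Q with b + 2 * c + 2 ≤? 2 * suc (j + r)
...   | yes stair = inj₁ (bc (b<B , c≤Q , inj₂ stair))
...   | no stair≰ with stair-overflow j r b c c≤Q c+j≰Q stair≰
...     | overflow p i b₀ = inj₂ (move-stair p i r b₀)

classify-ab : ∀ j r a b → b < B (j + r) → Region (j + r) j (suc a) b 0 ⊎ Move j r (suc a) b 0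
classify-ab j r a b b<B with a ≤? j + r
... | yes a≤Q = inj₁ (ab (near a≤Q b<B))
... | no a≰Q with a ≤? j + r + j
...   | no a≰Q+j with m≤n⇒∃[o]m+o≡n (≰⇒> a≰Q+j)
...     | a₀ , refl = inj₂ (move-a j r a₀ b)
classify-ab j r a b b<B | no a≰Q | yes a≤Q+j with b + 2 * suc a ≤? B (j + r) + 2 * suc (j + r)
... | yes b+2a≤ = inj₁ (ab (tail (≰⇒> a≰Q) a≤Q+j b+2a≤))
... | no tail≰ with tail-overflow j r a b (≰⇒> a≰Q) a≤Q+j tail≰
...   | overflow i p b₀ = inj₂ (move-tail i p r b₀)

classify : ∀ j r a b c → Region (j + r) j a b c ⊎ Move j r a b c
classify j r a b c with B (j + r) ≤? b
... | yes B≤b with m≤n⇒∃[o]m+o≡n B≤b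
...   | b₀ , refl = inj₂ (move-b j r a b₀ c)
classify j r zero    b c       | no b≮B = classify-bc j r b c (≰⇒> b≮B)
classify j r (suc a) b zero    | no b≮B = classify-ab j r a b (≰⇒> b≮B)
classify j r (suc a) b (suc c) | no _   = inj₂ (move-ac j r a b c)

record Reduct (j r a b c : ℕ) : Set where
  constructor reduct
  field
    a′ b′ c′ e : ℕ
    region     : Region (j + r) j a′ b′ c′
    congruent  : τ (j + r) a b c ≡ τ (j + r) a′ b′ c′ + e * m (j + r)

Reduct-step : ∀ {j r a b c a′ b′ c′} e → τ (j + r) a b c ≡ τ (j + r) a′ b′ c′ + e * m (j + r) →
              Reduct j r a′ b′ c′ → Reduct j r a b c
Reduct-step {j} {r} e eq (reduct a″ b″ c″ e′ region eq′) =
  reduct a″ b″ c″ (e′ + e) region (≡+*-trans e e′ (m (j + r)) eq eq′)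

reduce : ∀ j r a b c → Reduct j r a b c
reduce j r a b c = go a b c (<-wellFounded (weight j r a b c))
  where
  go : ∀ a b c → Acc _<_ (weight j r a b c) → Reduct j r a b c
  go a b c (acc smaller) with classify j r a b c
  ... | inj₁ region = reduct a b c 0 region (sym (+-identityʳ _))
  ... | inj₂ (move a′ b′ c′ e eq lighter) = Reduct-step e eq (go a′ b′ c′ (smaller lighter))

-- The shapes are L-shapes, pairwise different

Shape-closed : ∀ {Q j} → j ≤ Q → ∀ x y → Shape Q j x → y ≤ᵥ x → Shape Q j y
Shape-closed {Q} {j} j≤Q _ (a′ ∷ b′ ∷ c′ ∷ d′ ∷ []) (shape r) y≤x = close (y≤x 3F)
  where
  close : d′ ≤ 0 → Shape Q j (a′ ∷ b′ ∷ c′ ∷ d′ ∷ [])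
  close z≤n = shape (Region-closed j≤Q (y≤x 0F) (y≤x 1F) (y≤x 2F) r)

Shape-injective : ∀ {Q j} → j ≤ Q → ∀ x y t → Shape Q j x → Shape Q j y →
                  dot (gens Q) y + t * m Q ≡ dot (gens Q) x → x ≡ y
Shape-injective {Q} j≤Q _ _ t (shape {a} {b} {c} r) (shape {a′} {b′} {c′} r′) eq =
  same (Region-τ-injective (proj₁ τ-congruent) j≤Q r r′ (proj₂ τ-congruent))
  where
  τ-congruent = suc*+*-congruent (m Q) (τ Q a b c) (τ Q a′ b′ c′) t
                  (trans (cong (_+ t * m Q) (sym (dot-gens₀ Q a′ b′ c′))) (trans eq (dot-gens₀ Q a b c)))
  same : a ≡ a′ × b ≡ b′ × c ≡ c′ → (a ∷ b ∷ c ∷ 0 ∷ []) ≡ (a′ ∷ b′ ∷ c′ ∷ 0 ∷ [])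
  same (refl , refl , refl) = refl

Shape-reduce : ∀ j r z → ∃ λ y → Shape (j + r) j y ×
                 ∃ λ t → dot (gens (j + r)) z ≡ dot (gens (j + r)) y + t * m (j + r)
Shape-reduce j r (a ∷ b ∷ c ∷ d ∷ []) = lift (reduce j r a b c)
  where
  Q = j + r
  regroup : ∀ M x e d → suc M * (x + e * M) + d * M ≡ suc M * x + (suc M * e + d) * M
  regroup = solve-∀
  lift : Reduct j r a b c → ∃ λ y → Shape Q j y ×
           ∃ λ t → dot (gens Q) (a ∷ b ∷ c ∷ d ∷ []) ≡ dot (gens Q) y + t * m Q
  lift (reduct a′ b′ c′ e region eq) = (a′ ∷ b′ ∷ c′ ∷ 0 ∷ []) , shape region , t , (begin
    dot (gens Q) (a ∷ b ∷ c ∷ d ∷ [])         ≡⟨ dot-gens Q a b c d ⟩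
    M * τ Q a b c + d * m Q                   ≡⟨ cong (λ x → M * x + d * m Q) eq ⟩
    M * (τ Q a′ b′ c′ + e * m Q) + d * m Q    ≡⟨ regroup (m Q) (τ Q a′ b′ c′) e d ⟩
    M * τ Q a′ b′ c′ + t * m Q                ≡⟨ cong (_+ t * m Q) (dot-gens₀ Q a′ b′ c′) ⟨
    dot (gens Q) (a′ ∷ b′ ∷ c′ ∷ 0 ∷ []) + t * m Q ∎)
    where
    open ≡-Reasoning
    M = suc (m Q)
    t = M * e + d

Shape-isLShape : ∀ Q j → j ≤ Q → IsLShape (gens Q) (Apery (gens Q) (m Q)) (Shape Q j)
Shape-isLShape Q j j≤Q = subst (λ Q → IsLShape (gens Q) (Apery (gens Q) (m Q)) (Shape Q j)) Q≡j+r
  (Apery-isLShape (gens (j + r)) 3F (Shape (j + r) j) (s≤s z≤n)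
     (Shape-closed (m≤m+n j r)) (Shape-injective (m≤m+n j r)) (Shape-reduce j r))
  where
  r = proj₁ (m≤n⇒∃[o]m+o≡n j≤Q)
  Q≡j+r = proj₂ (m≤n⇒∃[o]m+o≡n j≤Q)

tail-point : ℕ → ℕ → Vec ℕ 4
tail-point Q i = suc (suc Q + i) ∷ 0 ∷ 0 ∷ 0 ∷ []

tail-point-∉ : ∀ Q i → ¬ Shape Q i (tail-point Q i)
tail-point-∉ Q i (shape (ab (near a≤Q _)))    = 1+n≰n (m+n≤o⇒m≤o (suc Q) a≤Q)
tail-point-∉ Q i (shape (ab (tail _ a≤Q+i _))) = 1+n≰n a≤Q+i

tail-point-∈ : ∀ {Q i j} → i < j → i ≤ Q → Shape Q j (tail-point Q i)
tail-point-∈ {Q} {i} {j} i<j i≤Q = shape (ab (tail (s≤s (m≤m+n Q i))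
  (subst (_≤ Q + j) (+-suc Q i) (+-monoʳ-≤ Q i<j))
  (begin
    2 * suc (suc Q + i)      ≤⟨ *-monoʳ-≤ 2 (s≤s (+-monoʳ-≤ (suc Q) i≤Q)) ⟩
    2 * suc (suc Q + Q)      ≤⟨ m≤n+m _ 3 ⟩
    3 + 2 * suc (suc Q + Q)  ≡⟨ regroup Q ⟩
    B Q + 2 * suc Q          ∎)))
  where
  open ≤-Reasoning
  regroup : ∀ Q → 3 + 2 * suc (suc Q + Q) ≡ 5 + 2 * Q + 2 * suc Q
  regroup = solve-∀

Shape-distinct : ∀ {Q i j} → i ≤ Q → j ≤ Q → i ≢ j → ¬ SameSet (Shape Q i) (Shape Q j)
Shape-distinct {Q} {i} {j} i≤Q j≤Q i≢j same with <-cmp i j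
... | tri< i<j _ _ = tail-point-∉ Q i (proj₂ (same (tail-point Q i)) (tail-point-∈ i<j i≤Q))
... | tri≈ _ i≡j _ = i≢j i≡j
... | tri> _ _ j<i = tail-point-∉ Q j (proj₁ (same (tail-point Q j)) (tail-point-∈ j<i j≤Q))

mainTheorem1 : (N : ℕ) → 1 ≤ N →
    Σ (Vec ℕ 4) λ n → IsMinGens4 n ×
      Σ (Fin N → Vec ℕ 4 → Set) λ Ls →
        ((j : Fin N) → IsLShape n (Apery n (lookup n (Fin.suc (Fin.suc (Fin.suc Fin.zero))))) (Ls j))
        × ((j j' : Fin N) → j ≢ j' → ¬ SameSet (Ls j) (Ls j'))
mainTheorem1 zero    ()
mainTheorem1 (suc q) _ =
  gens (suc q) , gens-minimal q , (λ k → Shape (suc q) (toℕ k)) ,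
  (λ k → Shape-isLShape (suc q) (toℕ k) (toℕ≤ k)) ,
  (λ k k′ k≢k′ → Shape-distinct (toℕ≤ k) (toℕ≤ k′) (k≢k′ ∘ toℕ-injective))
  where
  toℕ≤ : ∀ (k : Fin (suc q)) → toℕ k ≤ suc q
  toℕ≤ k = <⇒≤ (toℕ<n k)
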